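{- Fix an integer base $b \ge 2$ and a function $f_*:\{0,1,\dots,b-1\}\to\mathbb{Z}^{\ge 0}$, and let $f:\mathbb{Z}^{\ge 0}\to\mathbb{Z}^{\ge 0}$ be the associated digit map $f\left(\sum_{i=0}^n a_i b^i\right)=\sum_{i=0}^n f_*(a_i)$, where $\sum_{i=0}^n a_i b^i$ is the base-$b$ representation ($0\le a_i\le b-1$). Suppose $f(0)=0$, $f(1)=1$, $\gcd(b,f(b-1))=1$, and there is a digit $0\le m_*\le b-1$ such that $f(m_*)-m_*$ is relatively prime to $f(b-1)$. Then for any cycle number $u$ and any positive integer $n$, there exist $n$ consecutive positive integers each of which is a $u$-integer.
   Context: Write $f^r$ for the $r$-fold iterate of $f$. A positive integer $u$ is a cycle number if $f^r(u)=u$ for some $r\ge 1$ (i.e. $u$ lies in a cycle of $f$). Given a cycle number $u$, a positive integer $m$ is a $u$-integer if $f^r(m)=u$ for some $r\ge 1$. -}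

module Defs where

open import Data.Nat using (ℕ; zero; suc; _+_; _<_; _≤_; NonZero)
open import Data.Nat.DivMod using (_/_; _%_; m%n<n)
open import Data.Fin using (Fin; fromℕ<)
open import Data.List using (List; []; _∷_; map)
open import Data.Nat.ListAction using (sum)
open import Data.Product using (Σ; ∃; _×_)

-- Base-b digit list (least significant first) of a positive integer,
-- computed with fuel (fuel k suffices for all m ≤ k, since m / b < m).
-- The base-b representation of 0 is the single digit 0.
digitsFuel : (b : ℕ) .{{_ : NonZero b}} → ℕ → ℕ → List (Fin b)
digitsFuel b zero    m = []
digitsFuel b (suc k) zero = []
digitsFuel b (suc k) m@(suc _) = fromℕ< (m%n<n m b) ∷ digitsFuel b k (m / b)

digits : (b : ℕ) .{{_ : NonZero b}} → ℕ → List (Fin b)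
digits b zero = fromℕ< (m%n<n 0 b) ∷ []
digits b m@(suc _) = digitsFuel b m m

digitMap : (b : ℕ) .{{_ : NonZero b}} → (Fin b → ℕ) → ℕ → ℕ
digitMap b fstar n = sum (map fstar (digits b n))

iter : (ℕ → ℕ) → ℕ → ℕ → ℕ
iter f zero    x = x
iter f (suc r) x = f (iter f r x)

IsCycleNumber : (ℕ → ℕ) → ℕ → Set
IsCycleNumber f u = (0 < u) × ∃ λ r → (1 ≤ r) × (iter f r u ≡ u)
  where open import Relation.Binary.PropositionalEquality using (_≡_)

IsUInteger : (ℕ → ℕ) → ℕ → ℕ → Set
IsUInteger f u m = (0 < m) × ∃ λ r → (1 ≤ r) × (iter f r m ≡ u)
  where open import Relation.Binary.PropositionalEquality using (_≡_)

-- The digit map f is additive over blocks of base-b digits: f (y + A * b ^ L) = f y + f A whenever y < b ^ L.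
-- Let c = f (b ∸ 1).
--
-- First, every residue class mod c contains a u-integer. Some power O of b is ≡ 1 mod c, so the number with j
-- base-O digits m⋆ and w digits 1 is ≡ j m⋆ + w mod c, while f maps it to j f(m⋆) + w. Taking w = t₀ − j f(m⋆)
-- for a large u-integer t₀ yields u-integers ≡ t₀ − j (f(m⋆) − m⋆), which meet every class because f(m⋆) − m⋆
-- is invertible mod c.
--
-- Then every finite set F of offsets, with maximum m, has arbitrarily large translates M + F made of u-integers,
-- by induction on |F|. Let z + m = b ^ N. Induction gives M₁ with every M₁ + f (z + s), s < m, a u-integer; pick a
-- u-integer t ≤ M₁ + 1 with t ≡ M₁ + 1 mod c, so M₁ = (t − 1) + K c. Writing K digits b − 1 and then t − 1 ones
-- above z gives M with f (M + s) = M₁ + f (z + s) for s < m, while at s = m the carry leaves f (M + m) = t.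

module Submission where

open import Defs
open import Data.Nat using (ℕ; _+_; _∸_; _≤_; _<_; NonZero)
open import Data.Nat.GCD using (gcd)
open import Data.Integer using (ℤ; +_; _-_)
open import Data.Integer.GCD using () renaming (gcd to gcdℤ)
open import Data.Fin using (Fin)
open import Data.Product using (Σ; ∃; _×_)
open import Relation.Binary.PropositionalEquality using (_≡_)

open import Data.Nat using (suc; zero; _*_; _^_; _%_; _/_; _⊔_; _<?_; pred; z≤n; s≤s; ∣_-_∣; >-nonZero)
open import Data.Nat.Properties
open import Data.Nat.DivMod
open import Data.Nat.Divisibility using (_∣_; ∣m+n∣m⇒∣n; n∣m*n; ∣m⇒∣m*n; ∣-refl; _∣0)
open import Data.Nat.Coprimality using (Coprime; coprime-Bézout; gcd≡1⇒coprime)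
open import Data.Nat.GCD using (module Bézout)
open import Data.Nat.ListAction using (sum)
open import Data.Nat.ListAction.Properties using (sum-++)
open import Data.Nat.Solver using (module +-*-Solver)
open +-*-Solver using (solve; _:+_; _:*_; _:=_; con)
import Data.Integer as ℤ
import Data.Integer.Properties as ℤ
open import Data.Fin using (toℕ)
open import Data.Fin.Properties using (pigeonhole; toℕ-fromℕ<; fromℕ<-cong)
open import Data.List using (List; []; _∷_; map; replicate; _++_; filter; length; upTo)
open import Data.List.Properties using (map-++; map-replicate; filter-notAll; length-map)
open import Data.List.Extrema.Nat using (max; ⊥≤max; xs≤max; argmax-sel)
open import Data.List.Membership.Propositional using (_∈_)
open import Data.List.Membership.Propositional.Properties using (∈-map⁺; ∈-filter⁺; ∈-upTo⁺)
open import Data.List.Relation.Unary.All using (All; []; _∷_)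
import Data.List.Relation.Unary.All as All
open import Data.List.Relation.Unary.All.Properties using (replicate⁺; ++⁺)
open import Data.List.Relation.Unary.Any as Any using (here; there)
open import Data.Product using (_,_; proj₁; proj₂)
open import Data.Sum using ([_,_]′; inj₁; inj₂)
open import Function using (id)
open import Relation.Binary.PropositionalEquality using (refl; sym; trans; cong; cong₂; subst; subst₂; module ≡-Reasoning)
open import Relation.Nullary using (yes; no; contradiction)

IsUInteger-preimage : ∀ {f u x} → f 0 ≡ 0 → IsUInteger f u (f x) → IsUInteger f u x
IsUInteger-preimage {f} {x = zero} f0 (fx>0 , _) = contradiction (subst (0 <_) f0 fx>0) (<-irrefl refl)
IsUInteger-preimage {f} {x = x@(suc _)} _ (_ , r , _ , fʳ⁺¹x≡u) = s≤s z≤n , suc r , s≤s z≤n , trans (iter-suc r) fʳ⁺¹x≡u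
  where
  iter-suc : ∀ r → iter f (suc r) x ≡ iter f r (f x)
  iter-suc zero = refl
  iter-suc (suc r) = cong f (iter-suc r)

n<b^n : ∀ {b} .{{_ : NonZero b}} → 1 < b → ∀ n → n < b ^ n
n<b^n 1<b zero = s≤s z≤n
n<b^n {b} 1<b (suc n) = begin-strict
  suc n         ≤⟨ n<b^n 1<b n ⟩
  b ^ n         <⟨ m<m*n (b ^ n) b {{m^n≢0 b n}} 1<b ⟩
  b ^ n * b     ≡⟨ *-comm (b ^ n) b ⟩
  b ^ suc n     ∎
  where open ≤-Reasoning

sum-replicate : ∀ n x → sum (replicate n x) ≡ n * x
sum-replicate zero x = refl
sum-replicate (suc n) x = cong (_+_ x) (sum-replicate n x)

∈⇒≤max : ∀ {s} x xs → s ∈ x ∷ xs → s ≤ max x xs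
∈⇒≤max x xs = All.lookup (⊥≤max x xs ∷ xs≤max x xs)

max∈ : ∀ x xs → max x xs ∈ x ∷ xs
max∈ x xs = [ here , there ]′ (argmax-sel id x xs)

length-filter-<max : ∀ x xs → length (filter (_<? max x xs) (x ∷ xs)) < length (x ∷ xs)
length-filter-<max x xs = filter-notAll (_<? max x xs) (x ∷ xs) (Any.map (λ { refl → <-irrefl refl }) (max∈ x xs))

sum-replicate-++ : ∀ j x w y → sum (replicate j x ++ replicate w y) ≡ j * x + w * y
sum-replicate-++ j x w y = trans (sum-++ (replicate j x) _) (cong₂ _+_ (sum-replicate j x) (sum-replicate w y))

-- m + pred c * a is m − a modulo c, written without subtraction
coprime-+-pred* : ∀ {a m c} .{{_ : NonZero c}} → Coprime ∣ a - m ∣ c → Coprime (m + pred c * a) c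
coprime-+-pred* {a} {m} {c} a-m⊥c {i} (i∣δ , i∣c) = a-m⊥c (i∣∣a-m∣ , i∣c)
  where
  i∣ca : i ∣ c * a
  i∣ca = ∣m⇒∣m*n a i∣c
  ca≡ : c * a ≡ a + pred c * a
  ca≡ = cong (_* a) (sym (suc-pred c))
  i∣∣a-m∣ : i ∣ ∣ a - m ∣
  i∣∣a-m∣ with ≤-total m a
  ... | inj₁ m≤a = subst (i ∣_) (sym (m≤n⇒∣n-m∣≡n∸m m≤a)) (∣m+n∣m⇒∣n (subst (i ∣_) (begin
    c * a                        ≡⟨ ca≡ ⟩
    a + pred c * a               ≡⟨ cong (_+ pred c * a) (m+[n∸m]≡n m≤a) ⟨
    m + (a ∸ m) + pred c * a     ≡⟨ solve 3 (λ m d p → m :+ d :+ p := m :+ p :+ d) refl m (a ∸ m) (pred c * a) ⟩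
    m + pred c * a + (a ∸ m)     ∎) i∣ca) i∣δ)
    where open ≡-Reasoning
  ... | inj₂ a≤m = subst (i ∣_) (sym (m≤n⇒∣m-n∣≡n∸m a≤m)) (∣m+n∣m⇒∣n (subst (i ∣_) (begin
    m + pred c * a               ≡⟨ cong (_+ pred c * a) (m+[n∸m]≡n a≤m) ⟨
    a + (m ∸ a) + pred c * a     ≡⟨ solve 3 (λ a d p → a :+ d :+ p := a :+ p :+ d) refl a (m ∸ a) (pred c * a) ⟩
    a + pred c * a + (m ∸ a)     ≡⟨ cong (_+ (m ∸ a)) ca≡ ⟨
    c * a + (m ∸ a)              ∎) i∣δ) i∣ca)
    where open ≡-Reasoning

∣+m-+n∣≡∣m-n∣ : ∀ m n → ℤ.∣ + m - + n ∣ ≡ ∣ m - n ∣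
∣+m-+n∣≡∣m-n∣ m n with ≤-total m n
... | inj₁ m≤n = trans (cong ℤ.∣_∣ (ℤ.m-n≡m⊖n m n)) (trans (ℤ.∣⊖∣-≤ m≤n) (sym (m≤n⇒∣m-n∣≡n∸m m≤n)))
... | inj₂ n≤m = trans (cong ℤ.∣_∣ (ℤ.m-n≡m⊖n m n))
  (trans (ℤ.∣m⊖n∣≡∣n⊖m∣ m n) (trans (ℤ.∣⊖∣-≤ n≤m) (sym (m≤n⇒∣n-m∣≡n∸m n≤m))))

coprime⇒nonZero : ∀ {b n} → 1 < b → Coprime b n → NonZero n
coprime⇒nonZero {n = zero} 1<b b⊥0 = contradiction (b⊥0 (∣-refl , _ ∣0)) (>⇒≢ 1<b)
coprime⇒nonZero {n = suc _} _ _ = _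

evalDigits : ℕ → List ℕ → ℕ
evalDigits B [] = 0
evalDigits B (d ∷ ds) = d + evalDigits B ds * B

evalDigits-additive : ∀ {g : ℕ → ℕ} {B} → g 0 ≡ 0 →
  (∀ {y} A → y < B → g (y + A * B) ≡ g y + g A) →
  ∀ {ds} → All (_< B) ds → g (evalDigits B ds) ≡ sum (map g ds)
evalDigits-additive g0 _ [] = g0
evalDigits-additive g0 g-concat {d ∷ ds} (d<B ∷ ds<B) =
  trans (g-concat (evalDigits _ ds) d<B) (cong (_+_ _) (evalDigits-additive g0 g-concat ds<B))

module Congruence (C : ℕ) .{{_ : NonZero C}} where

  infix 4 _≈_
  _≈_ : ℕ → ℕ → Set
  a ≈ b = a % C ≡ b % C

  +-cong : ∀ {a a' b b'} → a ≈ a' → b ≈ b' → a + b ≈ a' + b'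
  +-cong {a} {a'} {b} {b'} a≈a' b≈b' = begin
    (a + b) % C              ≡⟨ %-distribˡ-+ a b C ⟩
    (a % C + b % C) % C      ≡⟨ cong₂ (λ x y → (x + y) % C) a≈a' b≈b' ⟩
    (a' % C + b' % C) % C    ≡⟨ %-distribˡ-+ a' b' C ⟨
    (a' + b') % C            ∎
    where open ≡-Reasoning

  *-cong : ∀ {a a' b b'} → a ≈ a' → b ≈ b' → a * b ≈ a' * b'
  *-cong {a} {a'} {b} {b'} a≈a' b≈b' = begin
    (a * b) % C              ≡⟨ %-distribˡ-* a b C ⟩
    (a % C * (b % C)) % C    ≡⟨ cong₂ (λ x y → (x * y) % C) a≈a' b≈b' ⟩
    (a' % C * (b' % C)) % C  ≡⟨ %-distribˡ-* a' b' C ⟨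
    (a' * b') % C            ∎
    where open ≡-Reasoning

  +-multiple : ∀ a k → a + k * C ≈ a
  +-multiple a k = [m+kn]%n≡m%n a k C

  ≤∧≈⇒+multiple : ∀ {t a} → t ≤ a → t ≈ a → ∃ λ k → a ≡ t + k * C
  ≤∧≈⇒+multiple {t} {a} t≤a t≈a = a / C ∸ t / C , (begin
    a                                ≡⟨ m≡m%n+[m/n]*n a C ⟩
    a % C + a / C * C                ≡⟨ cong₂ (λ r q → r + q * C) t≈a (m+[n∸m]≡n (/-monoˡ-≤ C t≤a)) ⟨
    t % C + (t / C + k) * C          ≡⟨ cong (_+_ (t % C)) (*-distribʳ-+ C (t / C) k) ⟩
    t % C + (t / C * C + k * C)      ≡⟨ +-assoc (t % C) _ _ ⟨
    t % C + t / C * C + k * C        ≡⟨ cong (_+ k * C) (m≡m%n+[m/n]*n t C) ⟨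
    t + k * C                        ∎)
    where
    open ≡-Reasoning
    k = a / C ∸ t / C

  invertible-cancelˡ : ∀ {α g x y} → α * g ≈ 1 → g * x ≈ g * y → x ≈ y
  invertible-cancelˡ {α} {g} {x} {y} αg≈1 gx≈gy = begin
    x % C              ≡⟨ cong (_% C) (*-identityˡ x) ⟨
    (1 * x) % C        ≡⟨ *-cong αg≈1 refl ⟨
    (α * g * x) % C    ≡⟨ cong (_% C) (*-assoc α g x) ⟩
    (α * (g * x)) % C  ≡⟨ *-cong {α} refl gx≈gy ⟩
    (α * (g * y)) % C  ≡⟨ cong (_% C) (*-assoc α g y) ⟨
    (α * g * y) % C    ≡⟨ *-cong αg≈1 refl ⟩
    (1 * y) % C        ≡⟨ cong (_% C) (*-identityˡ y) ⟩
    y % C              ∎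
    where open ≡-Reasoning

  coprime⇒invertible : ∀ {g} → Coprime g C → ∃ λ α → α * g ≈ 1
  coprime⇒invertible {g} g⊥C with coprime-Bézout g⊥C
  ... | Bézout.+- x y 1+yC≡xg = x , trans (cong (_% C) (sym 1+yC≡xg)) (+-multiple 1 y)
  ... | Bézout.-+ x y 1+xg≡yC = pred C * x , (begin
    (pred C * x * g) % C               ≡⟨ +-multiple (pred C * x * g) 1 ⟨
    (pred C * x * g + 1 * C) % C       ≡⟨ cong (_% C) identity ⟩
    (1 + pred C * y * C) % C           ≡⟨ +-multiple 1 (pred C * y) ⟩
    1 % C                              ∎)
    where
    open ≡-Reasoning
    -- x g ≡ −1, so (C − 1) x g ≡ 1
    identity : pred C * x * g + 1 * C ≡ 1 + pred C * y * C
    identity = begin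
      pred C * x * g + 1 * C             ≡⟨ cong (_+_ (pred C * x * g)) (trans (*-identityˡ C) (sym (suc-pred C))) ⟩
      pred C * x * g + suc (pred C)      ≡⟨ solve 3 (λ c x g → c :* x :* g :+ (con 1 :+ c) := con 1 :+ c :* (con 1 :+ x :* g)) refl (pred C) x g ⟩
      1 + pred C * (1 + x * g)           ≡⟨ cong (λ v → 1 + pred C * v) 1+xg≡yC ⟩
      1 + pred C * (y * C)               ≡⟨ cong (_+_ 1) (*-assoc (pred C) y C) ⟨
      1 + pred C * y * C                 ∎

  invertible-^ : ∀ {α g} n → α * g ≈ 1 → α ^ n * g ^ n ≈ 1
  invertible-^ zero αg≈1 = refl
  invertible-^ {α} {g} (suc n) αg≈1 = begin
    (α * α ^ n * (g * g ^ n)) % C     ≡⟨ cong (_% C) (solve 4 (λ a an g gn → a :* an :* (g :* gn) := a :* g :* (an :* gn)) refl α (α ^ n) g (g ^ n)) ⟩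
    (α * g * (α ^ n * g ^ n)) % C     ≡⟨ *-cong αg≈1 (invertible-^ n αg≈1) ⟩
    1                                  % C ∎
    where open ≡-Reasoning

  coprime⇒^≈1 : ∀ {g} → Coprime g C → ∃ λ o → g ^ suc o ≈ 1
  coprime⇒^≈1 {g} g⊥C with coprime⇒invertible g⊥C | pigeonhole (n<1+n C) (λ (i : Fin (suc C)) → (g ^ toℕ i) mod C)
  ... | α , αg≈1 | i , j , i<j , gⁱ≡gʲ = o , invertible-cancelˡ {α ^ p} {g ^ p} (invertible-^ {α} {g} p αg≈1) (begin
    (g ^ p * g ^ suc o) % C   ≡⟨ cong (_% C) (^-distribˡ-+-* g p (suc o)) ⟨
    (g ^ (p + suc o)) % C     ≡⟨ cong (λ e → (g ^ e) % C) (trans (+-suc p o) (m+[n∸m]≡n i<j)) ⟩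
    (g ^ toℕ j) % C           ≡⟨ trans (sym (toℕ-fromℕ< _)) (trans (cong toℕ gⁱ≡gʲ) (toℕ-fromℕ< _)) ⟨
    (g ^ p) % C               ≡⟨ cong (_% C) (*-identityʳ (g ^ p)) ⟨
    (g ^ p * 1) % C           ∎)
    where
    open ≡-Reasoning
    p o : ℕ
    p = toℕ i
    o = toℕ j ∸ suc p

  evalDigits-≈-sum : ∀ {B} → B ≈ 1 → ∀ ds → evalDigits B ds ≈ sum ds
  evalDigits-≈-sum B≈1 [] = refl
  evalDigits-≈-sum {B} B≈1 (d ∷ ds) = begin
    (d + evalDigits B ds * B) % C   ≡⟨ +-cong {d} refl (*-cong (evalDigits-≈-sum B≈1 ds) B≈1) ⟩
    (d + sum ds * 1) % C            ≡⟨ cong (λ v → (d + v) % C) (*-identityʳ (sum ds)) ⟩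
    (d + sum ds) % C                ∎
    where open ≡-Reasoning

  bounded-representatives : ∀ {P : ℕ → Set} → (∀ ρ → ∃ λ t → P t × t ≈ ρ) →
    ∃ λ bound → ∀ ρ → ∃ λ t → P t × t ≤ bound × t ≈ ρ
  bounded-representatives {P} represent = bound C , λ ρ →
    let t , Pt , t≤ , t≈ = below C (ρ % C) (m%n<n ρ C) in t , Pt , t≤ , trans t≈ (m%n%n≡m%n ρ C)
    where
    bound : ℕ → ℕ
    bound zero = 0
    bound (suc k) = bound k ⊔ proj₁ (represent k)
    below : ∀ k ρ → ρ < k → ∃ λ t → P t × t ≤ bound k × t ≈ ρ
    below (suc k) ρ ρ<1+k with ρ <? k
    ... | yes ρ<k = let t , Pt , t≤ , t≈ = below k ρ ρ<k in t , Pt , ≤-trans t≤ (m≤m⊔n _ _) , t≈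
    ... | no ρ≮k rewrite ≤-antisym (≤-pred ρ<1+k) (≮⇒≥ ρ≮k) =
      let t , Pt , t≈ = represent k in t , Pt , m≤n⊔m (bound k) t , t≈

module DigitMap (b : ℕ) .{{_ : NonZero b}} (1<b : 1 < b) (fstar : Fin b → ℕ)
  (f0 : digitMap b fstar 0 ≡ 0) (f1 : digitMap b fstar 1 ≡ 1) where

  f : ℕ → ℕ
  f = digitMap b fstar

  c : ℕ
  c = f (b ∸ 1)

  m/b<m : ∀ m .{{_ : NonZero m}} → m / b < m
  m/b<m m = m/n<m m b 1<b

  digitsFuel-irrelevant : ∀ {k k' m} → m ≤ k → m ≤ k' → digitsFuel b k m ≡ digitsFuel b k' m
  digitsFuel-irrelevant {zero}  {zero}   {zero} _ _ = refl
  digitsFuel-irrelevant {zero}  {suc _}  {zero} _ _ = refl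
  digitsFuel-irrelevant {suc _} {zero}   {zero} _ _ = refl
  digitsFuel-irrelevant {suc _} {suc _}  {zero} _ _ = refl
  digitsFuel-irrelevant {suc k} {suc k'} {m@(suc _)} m≤1+k m≤1+k' =
    cong (_ ∷_) (digitsFuel-irrelevant (quotient≤fuel m≤1+k) (quotient≤fuel m≤1+k'))
    where
    quotient≤fuel : ∀ {j} → m ≤ suc j → m / b ≤ j
    quotient≤fuel m≤1+j = ≤-pred (≤-trans (m/b<m m) m≤1+j)

  sum-digitsFuel : ∀ {k m} → m ≤ k → sum (map fstar (digitsFuel b k m)) ≡ f m
  sum-digitsFuel {zero}  {zero}    _   = sym f0
  sum-digitsFuel {suc _} {zero}    _   = sym f0
  sum-digitsFuel {k}     {suc m}   m≤k = cong (λ ds → sum (map fstar ds)) (digitsFuel-irrelevant m≤k ≤-refl)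

  digitMap-unfold : ∀ n → f n ≡ fstar (n mod b) + f (n / b)
  digitMap-unfold zero = cong (_+_ (fstar (0 mod b))) (sym (trans (cong f (0/n≡0 b)) f0))
  digitMap-unfold n@(suc n-1) = cong (_+_ (fstar (n mod b))) (sum-digitsFuel (≤-pred (m/b<m n)))

  digitMap-+-* : ∀ {r} q → r < b → f (r + q * b) ≡ f r + f q
  digitMap-+-* {r} q r<b = begin
    f (r + q * b)                                  ≡⟨ digitMap-unfold (r + q * b) ⟩
    fstar ((r + q * b) mod b) + f ((r + q * b) / b) ≡⟨ cong₂ _+_ (cong fstar last-digit) (cong f leading-digits) ⟩
    fstar (r mod b) + f q                          ≡⟨ cong (_+ f q) digit ⟨
    f r + f q                                      ∎
    where
    open ≡-Reasoning
    last-digit : (r + q * b) mod b ≡ r mod b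
    last-digit = fromℕ<-cong _ _ ([m+kn]%n≡m%n r q b) _ _
    leading-digits : (r + q * b) / b ≡ q
    leading-digits = begin
      (r + q * b) / b    ≡⟨ +-distrib-/-∣ʳ r (n∣m*n q) ⟩
      r / b + q * b / b  ≡⟨ cong₂ _+_ (m<n⇒m/n≡0 r<b) (m*n/n≡m q b) ⟩
      q                  ∎
    digit : f r ≡ fstar (r mod b)
    digit = begin
      f r                       ≡⟨ digitMap-unfold r ⟩
      fstar (r mod b) + f (r / b) ≡⟨ cong (λ x → fstar (r mod b) + f x) (m<n⇒m/n≡0 r<b) ⟩
      fstar (r mod b) + f 0     ≡⟨ cong (_+_ (fstar (r mod b))) f0 ⟩
      fstar (r mod b) + 0       ≡⟨ +-identityʳ _ ⟩
      fstar (r mod b)           ∎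

  digitMap-+-*^ : ∀ L {y} A → y < b ^ L → f (y + A * b ^ L) ≡ f y + f A
  digitMap-+-*^ zero {zero} A _ = trans (cong f (*-identityʳ A)) (cong (_+ f A) (sym f0))
  digitMap-+-*^ zero {suc _} A (s≤s ())
  digitMap-+-*^ (suc L) {y} A y<b^L+1 = begin
    f (y + A * (b * b ^ L))             ≡⟨ cong f regroup ⟩
    f (r + (q + A * b ^ L) * b)         ≡⟨ digitMap-+-* (q + A * b ^ L) r<b ⟩
    f r + f (q + A * b ^ L)             ≡⟨ cong (_+_ (f r)) (digitMap-+-*^ L A q<b^L) ⟩
    f r + (f q + f A)                   ≡⟨ +-assoc (f r) (f q) (f A) ⟨
    f r + f q + f A                     ≡⟨ cong (_+ f A) (trans (cong f y≡r+qb) (digitMap-+-* q r<b)) ⟨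
    f y + f A                           ∎
    where
    open ≡-Reasoning
    r = y % b
    q = y / b
    r<b : r < b
    r<b = m%n<n y b
    q<b^L : q < b ^ L
    q<b^L = m<n*o⇒m/o<n (subst (y <_) (*-comm b (b ^ L)) y<b^L+1)
    y≡r+qb : y ≡ r + q * b
    y≡r+qb = m≡m%n+[m/n]*n y b
    regroup : y + A * (b * b ^ L) ≡ r + (q + A * b ^ L) * b
    regroup = trans (cong (_+ A * (b * b ^ L)) y≡r+qb)
      (solve 5 (λ r q A b p → r :+ q :* b :+ A :* (b :* p) := r :+ (q :+ A :* p) :* b) refl r q A b (b ^ L))

  digitMap-^ : ∀ L → f (b ^ L) ≡ 1
  digitMap-^ L = begin
    f (b ^ L)          ≡⟨ cong f (*-identityˡ (b ^ L)) ⟨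
    f (0 + 1 * b ^ L)  ≡⟨ digitMap-+-*^ L 1 (m^n>0 b L) ⟩
    f 0 + f 1          ≡⟨ cong₂ _+_ f0 f1 ⟩
    1                  ∎
    where open ≡-Reasoning

  digitMap-evalDigits : ∀ L {ds} → All (_< b ^ L) ds → f (evalDigits (b ^ L) ds) ≡ sum (map f ds)
  digitMap-evalDigits L = evalDigits-additive f0 (λ A → digitMap-+-*^ L A)

  repdigit : ℕ → ℕ → ℕ
  repdigit d K = evalDigits b (replicate K d)

  digitMap-repdigit : ∀ {d} K → d < b → f (repdigit d K) ≡ K * f d
  digitMap-repdigit {d} K d<b = begin
    f (repdigit d K)                 ≡⟨ evalDigits-additive f0 digitMap-+-* (replicate⁺ K d<b) ⟩
    sum (map f (replicate K d))      ≡⟨ cong sum (map-replicate f K d) ⟩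
    sum (replicate K (f d))          ≡⟨ sum-replicate K (f d) ⟩
    K * f d                          ∎
    where open ≡-Reasoning

  1+repdigit[b-1] : ∀ K → suc (repdigit (b ∸ 1) K) ≡ b ^ K
  1+repdigit[b-1] zero = refl
  1+repdigit[b-1] (suc K) = begin
    suc (b ∸ 1) + repdigit (b ∸ 1) K * b   ≡⟨ cong (_+ repdigit (b ∸ 1) K * b) (suc-pred b) ⟩
    suc (repdigit (b ∸ 1) K) * b           ≡⟨ cong (_* b) (1+repdigit[b-1] K) ⟩
    b ^ K * b                              ≡⟨ *-comm (b ^ K) b ⟩
    b ^ suc K                              ∎
    where open ≡-Reasoning

  b-1<b : b ∸ 1 < b
  b-1<b = subst (b ∸ 1 <_) (suc-pred b) (n<1+n (b ∸ 1))

  b^n<b^[1+n] : ∀ n → b ^ n < b ^ suc n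
  b^n<b^[1+n] n = ^-monoʳ-< b 1<b (n<1+n n)

  b^N+repdigit[b-1] : ∀ N K → b ^ N + repdigit (b ∸ 1) K * b ^ N ≡ b ^ (K + N)
  b^N+repdigit[b-1] N K = begin
    suc (repdigit (b ∸ 1) K) * b ^ N   ≡⟨ cong (_* b ^ N) (1+repdigit[b-1] K) ⟩
    b ^ K * b ^ N                      ≡⟨ ^-distribˡ-+-* b K N ⟨
    b ^ (K + N)                        ∎
    where open ≡-Reasoning

  -- the digits of y (read as N digits when y < b ^ N), then K digits b ∸ 1, then P ones
  padded : (N K P y : ℕ) → ℕ
  padded N K P y = y + repdigit (b ∸ 1) K * b ^ N + repdigit 1 P * b ^ suc (K + N)

  padded-+ : ∀ N K P y s → padded N K P y + s ≡ padded N K P (y + s)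
  padded-+ N K P y s = solve 4 (λ y s r p → y :+ r :+ p :+ s := y :+ s :+ r :+ p) refl
    y s (repdigit (b ∸ 1) K * b ^ N) (repdigit 1 P * b ^ suc (K + N))

  digitMap-+-repunit* : ∀ L P {y} → y < b ^ L → f (y + repdigit 1 P * b ^ L) ≡ f y + P
  digitMap-+-repunit* L P {y} y<b^L = begin
    f (y + repdigit 1 P * b ^ L)   ≡⟨ digitMap-+-*^ L (repdigit 1 P) y<b^L ⟩
    f y + f (repdigit 1 P)         ≡⟨ cong (_+_ (f y)) (digitMap-repdigit P 1<b) ⟩
    f y + P * f 1                  ≡⟨ cong (λ x → f y + P * x) f1 ⟩
    f y + P * 1                    ≡⟨ cong (_+_ (f y)) (*-identityʳ P) ⟩
    f y + P                        ∎
    where open ≡-Reasoning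

  digitMap-padded : ∀ N K P {y} → y < b ^ N → f (padded N K P y) ≡ f y + K * c + P
  digitMap-padded N K P {y} y<b^N = begin
    f (padded N K P y)                          ≡⟨ digitMap-+-repunit* (suc (K + N)) P low<b^L ⟩
    f (y + repdigit (b ∸ 1) K * b ^ N) + P      ≡⟨ cong (_+ P) (digitMap-+-*^ N (repdigit (b ∸ 1) K) y<b^N) ⟩
    f y + f (repdigit (b ∸ 1) K) + P            ≡⟨ cong (λ x → f y + x + P) (digitMap-repdigit K b-1<b) ⟩
    f y + K * c + P                             ∎
    where
    open ≡-Reasoning
    low<b^L : y + repdigit (b ∸ 1) K * b ^ N < b ^ suc (K + N)
    low<b^L = <-trans (subst (y + repdigit (b ∸ 1) K * b ^ N <_) (b^N+repdigit[b-1] N K)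
      (+-monoˡ-< (repdigit (b ∸ 1) K * b ^ N) y<b^N)) (b^n<b^[1+n] (K + N))

  digitMap-padded-b^N : ∀ N K P → f (padded N K P (b ^ N)) ≡ suc P
  digitMap-padded-b^N N K P = begin
    f (padded N K P (b ^ N))                         ≡⟨ cong (λ x → f (x + repdigit 1 P * b ^ suc (K + N))) (b^N+repdigit[b-1] N K) ⟩
    f (b ^ (K + N) + repdigit 1 P * b ^ suc (K + N)) ≡⟨ digitMap-+-repunit* (suc (K + N)) P (b^n<b^[1+n] (K + N)) ⟩
    f (b ^ (K + N)) + P                              ≡⟨ cong (_+ P) (digitMap-^ (K + N)) ⟩
    suc P                                            ∎
    where open ≡-Reasoning

module UIntegers (b : ℕ) .{{_ : NonZero b}} (1<b : 1 < b) (fstar : Fin b → ℕ)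
  (f0 : digitMap b fstar 0 ≡ 0) (f1 : digitMap b fstar 1 ≡ 1)
  .{{_ : NonZero (digitMap b fstar (b ∸ 1))}} (u : ℕ) where

  open DigitMap b 1<b fstar f0 f1
  open Congruence c

  UInteger : ℕ → Set
  UInteger = IsUInteger f u

  padded-UInteger : ∀ N K {m z t M₁ s} → z + m ≡ b ^ N → UInteger t → suc M₁ ≡ t + K * c →
    s ≤ m → (s < m → UInteger (M₁ + f (z + s))) → UInteger (padded N K (pred t) z + s)
  padded-UInteger _ _ {t = zero} _ (() , _)
  padded-UInteger N K {m} {z} {suc P} {M₁} {s} z+m≡b^N Ut 1+M₁≡t+Kc s≤m lowerU
    with m≤n⇒m<n∨m≡n s≤m
  ... | inj₁ s<m = IsUInteger-preimage f0 (subst UInteger (sym fM+s≡M₁+fz+s) (lowerU s<m))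
    where
    open ≡-Reasoning
    z+s<b^N : z + s < b ^ N
    z+s<b^N = subst (z + s <_) z+m≡b^N (+-monoʳ-< z s<m)
    fM+s≡M₁+fz+s : f (padded N K P z + s) ≡ M₁ + f (z + s)
    fM+s≡M₁+fz+s = begin
      f (padded N K P z + s)    ≡⟨ cong f (padded-+ N K P z s) ⟩
      f (padded N K P (z + s))  ≡⟨ digitMap-padded N K P z+s<b^N ⟩
      f (z + s) + K * c + P     ≡⟨ solve 3 (λ x y p → x :+ y :+ p := p :+ y :+ x) refl (f (z + s)) (K * c) P ⟩
      P + K * c + f (z + s)     ≡⟨ cong (_+ f (z + s)) (suc-injective 1+M₁≡t+Kc) ⟨
      M₁ + f (z + s)            ∎
  ... | inj₂ refl = IsUInteger-preimage f0 (subst UInteger (sym fM+m≡t) Ut)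
    where
    open ≡-Reasoning
    fM+m≡t : f (padded N K P z + m) ≡ suc P
    fM+m≡t = begin
      f (padded N K P z + m)    ≡⟨ cong f (padded-+ N K P z m) ⟩
      f (padded N K P (z + m))  ≡⟨ cong (λ y → f (padded N K P y)) z+m≡b^N ⟩
      f (padded N K P (b ^ N))  ≡⟨ digitMap-padded-b^N N K P ⟩
      suc P                     ∎

  translates-into-UIntegers : (∃ λ bound → ∀ ρ → ∃ λ t → UInteger t × t ≤ bound × t ≈ ρ) →
    ∀ F B → ∃ λ M → B ≤ M × (∀ {s} → s ∈ F → UInteger (M + s))
  translates-into-UIntegers (bound , represent) F = go (length F) F ≤-refl
    where
    go : ∀ n F → length F ≤ n → ∀ B → ∃ λ M → B ≤ M × (∀ {s} → s ∈ F → UInteger (M + s))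
    go _ [] _ B = B , ≤-refl , λ ()
    go (suc n) (x ∷ xs) |F|≤1+n B = step (go n lower |lower|≤n bound)
      where
      m N z : ℕ
      m = max x xs
      N = m + B
      z = b ^ N ∸ m
      z+m≡b^N : z + m ≡ b ^ N
      z+m≡b^N = m∸n+n≡m (≤-trans (m≤m+n m B) (<⇒≤ (n<b^n 1<b N)))
      B<z : B < z
      B<z = +-cancelʳ-< m B z (subst₂ _<_ (+-comm m B) (sym z+m≡b^N) (n<b^n 1<b N))
      lower : List ℕ
      lower = map (λ s → f (z + s)) (filter (_<? m) (x ∷ xs))
      |lower|≤n : length lower ≤ n
      |lower|≤n = subst (_≤ n) (sym (length-map _ (filter (_<? m) (x ∷ xs))))
        (≤-pred (≤-trans (length-filter-<max x xs) |F|≤1+n))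
      step : (∃ λ M₁ → bound ≤ M₁ × (∀ {s} → s ∈ lower → UInteger (M₁ + s))) →
             ∃ λ M → B ≤ M × (∀ {s} → s ∈ x ∷ xs → UInteger (M + s))
      step (M₁ , bound≤M₁ , M₁+lower⊆U) with represent (suc M₁)
      ... | t , Ut , t≤bound , t≈1+M₁ with ≤∧≈⇒+multiple (≤-trans t≤bound (≤-trans bound≤M₁ (n≤1+n M₁))) t≈1+M₁
      ... | K , 1+M₁≡t+Kc = padded N K (pred t) z , ≤-trans (<⇒≤ B<z) (≤-trans (m≤m+n z _) (m≤m+n _ _)) ,
        λ {s} s∈F → padded-UInteger N K z+m≡b^N Ut 1+M₁≡t+Kc (∈⇒≤max x xs s∈F)
          (λ s<m → M₁+lower⊆U (∈-map⁺ _ (∈-filter⁺ (_<? m) s∈F s<m)))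

  module _ (Uu : UInteger u) (b⊥c : Coprime b c) {m⋆} (m⋆<b : m⋆ < b) (fm⋆-m⋆⊥c : Coprime ∣ f m⋆ - m⋆ ∣ c) where

    private
      o O : ℕ
      o = proj₁ (coprime⇒^≈1 b⊥c)
      O = b ^ suc o
      O≈1 : O ≈ 1
      O≈1 = proj₂ (coprime⇒^≈1 b⊥c)
      δ α : ℕ
      δ = m⋆ + pred c * f m⋆
      α = proj₁ (coprime⇒invertible (coprime-+-pred* {f m⋆} {m⋆} fm⋆-m⋆⊥c))
      αδ≈1 : α * δ ≈ 1
      αδ≈1 = proj₂ (coprime⇒invertible (coprime-+-pred* {f m⋆} {m⋆} fm⋆-m⋆⊥c))

    mixed : ℕ → ℕ → ℕ
    mixed j w = evalDigits O (replicate j m⋆ ++ replicate w 1)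

    digitMap-mixed : ∀ j w → f (mixed j w) ≡ j * f m⋆ + w
    digitMap-mixed j w = begin
      f (mixed j w)                                   ≡⟨ digitMap-evalDigits (suc o) (++⁺ (replicate⁺ j (<-≤-trans m⋆<b b≤O)) (replicate⁺ w (<-≤-trans 1<b b≤O))) ⟩
      sum (map f (replicate j m⋆ ++ replicate w 1))  ≡⟨ cong sum (trans (map-++ f (replicate j m⋆) _) (cong₂ _++_ (map-replicate f j m⋆) (map-replicate f w 1))) ⟩
      sum (replicate j (f m⋆) ++ replicate w (f 1))  ≡⟨ sum-replicate-++ j (f m⋆) w (f 1) ⟩
      j * f m⋆ + w * f 1                              ≡⟨ cong (λ x → j * f m⋆ + w * x) f1 ⟩
      j * f m⋆ + w * 1                                ≡⟨ cong (_+_ (j * f m⋆)) (*-identityʳ w) ⟩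
      j * f m⋆ + w                                    ∎
      where
      open ≡-Reasoning
      b≤O : b ≤ O
      b≤O = subst (_≤ O) (*-identityʳ b) (*-monoʳ-≤ b (m^n>0 b o))

    mixed≈ : ∀ j w → mixed j w ≈ j * m⋆ + w
    mixed≈ j w = begin
      mixed j w % c                              ≡⟨ evalDigits-≈-sum O≈1 (replicate j m⋆ ++ replicate w 1) ⟩
      sum (replicate j m⋆ ++ replicate w 1) % c  ≡⟨ cong (_% c) (trans (sum-replicate-++ j m⋆ w 1) (cong (_+_ (j * m⋆)) (*-identityʳ w))) ⟩
      (j * m⋆ + w) % c                           ∎
      where open ≡-Reasoning

    -- padded with c * f m⋆ zeros so that j * f m⋆ ≤ t₀ for every j < c
    t₀ : ℕ
    t₀ = repdigit 1 u * b ^ (c * f m⋆)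

    UInteger-t₀ : UInteger t₀
    UInteger-t₀ = IsUInteger-preimage f0 (subst UInteger (sym ft₀≡u) Uu)
      where
      ft₀≡u : f t₀ ≡ u
      ft₀≡u = trans (digitMap-+-repunit* (c * f m⋆) u (m^n>0 b (c * f m⋆))) (cong (_+ u) f0)

    *fm⋆≤t₀ : ∀ {j} → j < c → j * f m⋆ ≤ t₀
    *fm⋆≤t₀ {j} j<c = begin
      j * f m⋆          ≤⟨ *-monoˡ-≤ (f m⋆) (<⇒≤ j<c) ⟩
      c * f m⋆          ≤⟨ <⇒≤ (n<b^n 1<b (c * f m⋆)) ⟩
      b ^ (c * f m⋆)    ≤⟨ m≤n*m (b ^ (c * f m⋆)) (repdigit 1 u) {{>-nonZero (repunit>0 (proj₁ Uu))}} ⟩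
      t₀                ∎
      where
      open ≤-Reasoning
      repunit>0 : ∀ {n} → 0 < n → 0 < repdigit 1 n
      repunit>0 {suc _} _ = s≤s z≤n

    UInteger-mixed : ∀ {j} → j < c → UInteger (mixed j (t₀ ∸ j * f m⋆))
    UInteger-mixed {j} j<c = IsUInteger-preimage f0
      (subst UInteger (sym (trans (digitMap-mixed j _) (m+[n∸m]≡n (*fm⋆≤t₀ j<c)))) UInteger-t₀)

    mixed≈*δ+t₀ : ∀ {j} → j < c → mixed j (t₀ ∸ j * f m⋆) ≈ j * δ + t₀
    mixed≈*δ+t₀ {j} j<c = begin
      mixed j w % c                          ≡⟨ mixed≈ j w ⟩
      (j * m⋆ + w) % c                       ≡⟨ +-multiple (j * m⋆ + w) (j * f m⋆) ⟨
      (j * m⋆ + w + j * f m⋆ * c) % c        ≡⟨ cong (λ x → (j * m⋆ + w + j * f m⋆ * x) % c) (suc-pred c) ⟨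
      (j * m⋆ + w + j * f m⋆ * suc (pred c)) % c
        ≡⟨ cong (_% c) (solve 5 (λ j m w a p → j :* m :+ w :+ j :* a :* (con 1 :+ p) := j :* (m :+ p :* a) :+ (w :+ j :* a)) refl j m⋆ w (f m⋆) (pred c)) ⟩
      (j * δ + (w + j * f m⋆)) % c           ≡⟨ cong (λ x → (j * δ + x) % c) (m∸n+n≡m (*fm⋆≤t₀ j<c)) ⟩
      (j * δ + t₀) % c                       ∎
      where
      open ≡-Reasoning
      w : ℕ
      w = t₀ ∸ j * f m⋆

    every-residue-has-UInteger : ∀ ρ → ∃ λ t → UInteger t × t ≈ ρ
    every-residue-has-UInteger ρ = mixed j (t₀ ∸ j * f m⋆) , UInteger-mixed j<c , trans (mixed≈*δ+t₀ j<c) (begin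
      (j * δ + t₀) % c         ≡⟨ +-cong (*-cong {j} {α * V} (m%n%n≡m%n (α * V) c) refl) refl ⟩
      (α * V * δ + t₀) % c     ≡⟨ cong (λ x → (x + t₀) % c) (solve 3 (λ a v d → a :* v :* d := a :* d :* v) refl α V δ) ⟩
      (α * δ * V + t₀) % c     ≡⟨ +-cong (*-cong {α * δ} {1} αδ≈1 refl) refl ⟩
      (1 * V + t₀) % c         ≡⟨ cong (_% c) (solve 3 (λ r t p → con 1 :* (r :+ p :* t) :+ t := r :+ t :* (con 1 :+ p)) refl ρ t₀ (pred c)) ⟩
      (ρ + t₀ * suc (pred c)) % c ≡⟨ cong (λ x → (ρ + t₀ * x) % c) (suc-pred c) ⟩
      (ρ + t₀ * c) % c         ≡⟨ +-multiple ρ t₀ ⟩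
      ρ % c                    ∎)
      where
      open ≡-Reasoning
      V j : ℕ
      V = ρ + pred c * t₀
      j = (α * V) % c
      j<c : j < c
      j<c = m%n<n (α * V) c

    consecutive-UIntegers : ∀ n → ∃ λ k → 0 < k × (∀ i → i < n → UInteger (k + i))
    consecutive-UIntegers n =
      let k , 1≤k , k+upTo⊆U = translates-into-UIntegers (bounded-representatives every-residue-has-UInteger) (upTo n) 1
      in k , 1≤k , λ i i<n → k+upTo⊆U (∈-upTo⁺ i<n)

theorem1p1 : (b : ℕ) .{{_ : NonZero b}} → 2 ≤ b → (fstar : Fin b → ℕ) →
    digitMap b fstar 0 ≡ 0 →
    digitMap b fstar 1 ≡ 1 →
    gcd b (digitMap b fstar (b ∸ 1)) ≡ 1 →
    (∃ λ mstar → (mstar ≤ b ∸ 1) ×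
      (gcdℤ ((+ digitMap b fstar mstar) - (+ mstar)) (+ digitMap b fstar (b ∸ 1)) ≡ + 1)) →
    (u : ℕ) → IsCycleNumber (digitMap b fstar) u →
    (n : ℕ) → 0 < n →
    ∃ λ k → (0 < k) × ((i : ℕ) → i < n → IsUInteger (digitMap b fstar) u (k + i))
-- A cycle number is, by definition, a u-integer for itself.
theorem1p1 b 1<b fstar f0 f1 gcd[b,c]≡1 (m⋆ , m⋆≤b-1 , gcd[fm⋆-m⋆,c]≡1) u cycle n _ =
  consecutive-UIntegers cycle b⊥c (≤-<-trans m⋆≤b-1 b-1<b) fm⋆-m⋆⊥c n
  where
  b⊥c : Coprime b (digitMap b fstar (b ∸ 1))
  b⊥c = gcd≡1⇒coprime gcd[b,c]≡1
  instance
    c≢0 : NonZero (digitMap b fstar (b ∸ 1))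
    c≢0 = coprime⇒nonZero 1<b b⊥c
  open DigitMap b 1<b fstar f0 f1 using (b-1<b)
  open UIntegers b 1<b fstar f0 f1 u
  fm⋆-m⋆⊥c : Coprime ∣ digitMap b fstar m⋆ - m⋆ ∣ (digitMap b fstar (b ∸ 1))
  fm⋆-m⋆⊥c = gcd≡1⇒coprime (trans (cong (λ x → gcd x _) (sym (∣+m-+n∣≡∣m-n∣ _ m⋆))) (ℤ.+-injective gcd[fm⋆-m⋆,c]≡1))
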